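{- In the calculus described in the context, for every term $r$ and types $A,B$: if $r:A$ and $r:B$ are both derivable, then $A\equiv B$.
   Context: Types are given by the grammar $A,B,C ::= X \mid A\Rightarrow B \mid A\wedge B \mid \forall X.A$ ($X$ ranging over type variables). The relation $\equiv$ on types is the equivalence relation (compatible with the type constructors) generated by the three equations $A\wedge B\equiv B\wedge A$, $(A\wedge B)\wedge C\equiv A\wedge(B\wedge C)$, and $A\Rightarrow(B\wedge C)\equiv (A\Rightarrow B)\wedge(A\Rightarrow C)$. Terms (Church-style, every variable occurrence carries a type) are given by $r,s,t ::= x^A \mid \lambda x^A.r \mid r\,s \mid r+s \mid \pi_A(r) \mid \Lambda X.r \mid r\{A\}$; the same variable name with different type annotations counts as a different variable, and terms and types are taken up to $\alpha$-conversion. If the free variables of $r$ are $x_1^{A_1},\dots,x_n^{A_n}$, write $\Gamma(r)=\{A_1,\dots,A_n\}$ and $FV(\Gamma(r))=\bigcup_i FV(A_i)$. Typing judgements have the form $r:A$ (no context) and are derived by the rules: (ax) $x^A:A$; ($\equiv$) from $r:A$ and $A\equiv B$ infer $r:B$; ($\Rightarrow_I$) from $r:B$ infer $\lambda x^A.r:A\Rightarrow B$; ($\Rightarrow_E$) from $r:A\Rightarrow B$ and $s:A$ infer $r\,s:B$; ($\wedge_I$) from $r:A$ and $s:B$ infer $r+s:A\wedge B$; ($\wedge_E$) from $r:A\wedge B$ infer $\pi_A(r):A$; ($\forall_I$) from $r:A$ with $X\notin FV(\Gamma(r))$ infer $\Lambda X.r:\forall X.A$; ($\forall_E$) from $r:\forall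 X.A$ infer $r\{B\}:A[B/X]$. -}

module Defs where

open import Data.Nat using (ℕ; zero; suc)
open import Data.Product using (_×_; _,_)
open import Relation.Binary.PropositionalEquality using (_≢_)
open import Relation.Nullary using (¬_)

-- Types, with type variables as de Bruijn indices (so types are
-- automatically taken up to α-conversion).
--   tv n   : type variable X
--   A ⇒ B, A ∧ B
--   ∀' A   : ∀X.A, binding index 0 in A
infixr 7 _⇒_
infixr 8 _∧_
data Ty : Set where
  tv  : ℕ → Ty
  _⇒_ : Ty → Ty → Ty
  _∧_ : Ty → Ty → Ty
  ∀'  : Ty → Ty

ext : (ℕ → ℕ) → ℕ → ℕ
ext ρ zero    = zero
ext ρ (suc n) = suc (ρ n)

rename : (ℕ → ℕ) → Ty → Ty
rename ρ (tv n)  = tv (ρ n)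
rename ρ (A ⇒ B) = rename ρ A ⇒ rename ρ B
rename ρ (A ∧ B) = rename ρ A ∧ rename ρ B
rename ρ (∀' A)  = ∀' (rename (ext ρ) A)

shift : Ty → Ty
shift = rename suc

exts : (ℕ → Ty) → ℕ → Ty
exts σ zero    = tv zero
exts σ (suc n) = shift (σ n)

subst : (ℕ → Ty) → Ty → Ty
subst σ (tv n)  = σ n
subst σ (A ⇒ B) = subst σ A ⇒ subst σ B
subst σ (A ∧ B) = subst σ A ∧ subst σ B
subst σ (∀' A)  = ∀' (subst (exts σ) A)

-- single substitution for index 0 (decrementing the others):
-- for ∀' A,  A [ B ]  is  A[B/X]
single : Ty → ℕ → Ty
single B zero    = B
single B (suc n) = tv n

_[_] : Ty → Ty → Ty
A [ B ] = subst (single B) A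

data TyFree : ℕ → Ty → Set where
  f-tv  : ∀ {n} → TyFree n (tv n)
  f-⇒ˡ  : ∀ {n A B} → TyFree n A → TyFree n (A ⇒ B)
  f-⇒ʳ  : ∀ {n A B} → TyFree n B → TyFree n (A ⇒ B)
  f-∧ˡ  : ∀ {n A B} → TyFree n A → TyFree n (A ∧ B)
  f-∧ʳ  : ∀ {n A B} → TyFree n B → TyFree n (A ∧ B)
  f-∀   : ∀ {n A} → TyFree (suc n) A → TyFree n (∀' A)

infix 4 _≅_
data _≅_ : Ty → Ty → Set where
  ≅-refl  : ∀ {A} → A ≅ A
  ≅-sym   : ∀ {A B} → A ≅ B → B ≅ A
  ≅-trans : ∀ {A B C} → A ≅ B → B ≅ C → A ≅ C
  ≅-comm  : ∀ {A B} → A ∧ B ≅ B ∧ A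
  ≅-assoc : ∀ {A B C} → (A ∧ B) ∧ C ≅ A ∧ (B ∧ C)
  ≅-distr : ∀ {A B C} → A ⇒ (B ∧ C) ≅ (A ⇒ B) ∧ (A ⇒ C)
  ≅-⇒     : ∀ {A A' B B'} → A ≅ A' → B ≅ B' → A ⇒ B ≅ A' ⇒ B'
  ≅-∧     : ∀ {A A' B B'} → A ≅ A' → B ≅ B' → A ∧ B ≅ A' ∧ B'
  ≅-∀     : ∀ {A A'} → A ≅ A' → ∀' A ≅ ∀' A'

-- Term variables are names (ℕ) together with their
-- type annotation; x^A and x^B with A ≠ B are different variables.
-- Type variables in annotations are de Bruijn; tΛ r binds type index 0 in
-- all annotations inside r.
data Term : Set where
  var  : ℕ → Ty → Term
  lam  : ℕ → Ty → Term → Term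
  app  : Term → Term → Term
  plus : Term → Term → Term
  proj : Ty → Term → Term
  tΛ   : Term → Term
  tapp : Term → Ty → Term

-- FreeVar r x A : the variable x^A occurs free in r
-- (A expressed in the type context of r itself).
data FreeVar : Term → ℕ → Ty → Set where
  fv-var   : ∀ {x A} → FreeVar (var x A) x A
  fv-lam   : ∀ {r x A y B} → FreeVar r x A → (x , A) ≢ (y , B) →
             FreeVar (lam y B r) x A
  fv-appˡ  : ∀ {r s x A} → FreeVar r x A → FreeVar (app r s) x A
  fv-appʳ  : ∀ {r s x A} → FreeVar s x A → FreeVar (app r s) x A
  fv-plusˡ : ∀ {r s x A} → FreeVar r x A → FreeVar (plus r s) x A
  fv-plusʳ : ∀ {r s x A} → FreeVar s x A → FreeVar (plus r s) x A
  fv-proj  : ∀ {r x A B} → FreeVar r x A → FreeVar (proj B r) x A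
  fv-tΛ    : ∀ {r x A} → FreeVar r x (shift A) → FreeVar (tΛ r) x A
  fv-tapp  : ∀ {r x A B} → FreeVar r x A → FreeVar (tapp r B) x A

NotFreeInCtx : ℕ → Term → Set
NotFreeInCtx n r = ∀ x A → FreeVar r x A → ¬ TyFree n A

infix 3 _⦂_
data _⦂_ : Term → Ty → Set where
  ax   : ∀ {x A} → var x A ⦂ A
  conv : ∀ {r A B} → r ⦂ A → A ≅ B → r ⦂ B
  ⇒I   : ∀ {x r A B} → r ⦂ B → lam x A r ⦂ A ⇒ B
  ⇒E   : ∀ {r s A B} → r ⦂ A ⇒ B → s ⦂ A → app r s ⦂ B
  ∧I   : ∀ {r s A B} → r ⦂ A → s ⦂ B → plus r s ⦂ A ∧ B
  ∧E   : ∀ {r A B} → r ⦂ A ∧ B → proj A r ⦂ A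
  ∀I   : ∀ {r A} → r ⦂ A → NotFreeInCtx zero r → tΛ r ⦂ ∀' A
  ∀E   : ∀ {r A B} → r ⦂ ∀' A → tapp r B ⦂ A [ B ]

-- Apart from the conversion rule, typing is syntax directed, so by induction
-- on both derivations uniqueness reduces to two injectivity facts modulo ≡,
-- A ⇒ B ≡ A' ⇒ B' ⊢ B ≡ B' and ∀X.A ≡ ∀X.A' ⊢ A ≡ A', plus stability of ≡
-- under substitution. Each injectivity fact comes from a map on types that
-- extracts the component in question from the head constructor, commutes
-- with ∧, and sends every generating equation of ≡ to an instance of ≡.
module Submission where

open import Defs

codomain : Ty → Ty
codomain (A ⇒ B) = B
codomain (A ∧ B) = codomain A ∧ codomain B
codomain A       = A

codomain-cong : ∀ {A B} → A ≅ B → codomain A ≅ codomain B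
codomain-cong ≅-refl        = ≅-refl
codomain-cong (≅-sym e)     = ≅-sym (codomain-cong e)
codomain-cong (≅-trans e f) = ≅-trans (codomain-cong e) (codomain-cong f)
codomain-cong ≅-comm        = ≅-comm
codomain-cong ≅-assoc       = ≅-assoc
codomain-cong ≅-distr       = ≅-refl
codomain-cong (≅-⇒ _ f)     = f
codomain-cong (≅-∧ e f)     = ≅-∧ (codomain-cong e) (codomain-cong f)
codomain-cong (≅-∀ e)       = ≅-∀ e

⇒-injectiveʳ : ∀ {A A' B B'} → A ⇒ B ≅ A' ⇒ B' → B ≅ B'
⇒-injectiveʳ = codomain-cong

-- The arrow must be kept for distributivity to be respected.
body : Ty → Ty
body (∀' A)  = A
body (A ⇒ B) = A ⇒ body B
body (A ∧ B) = body A ∧ body B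
body (tv n)  = tv n

body-cong : ∀ {A B} → A ≅ B → body A ≅ body B
body-cong ≅-refl        = ≅-refl
body-cong (≅-sym e)     = ≅-sym (body-cong e)
body-cong (≅-trans e f) = ≅-trans (body-cong e) (body-cong f)
body-cong ≅-comm        = ≅-comm
body-cong ≅-assoc       = ≅-assoc
body-cong ≅-distr       = ≅-distr
body-cong (≅-⇒ e f)     = ≅-⇒ e (body-cong f)
body-cong (≅-∧ e f)     = ≅-∧ (body-cong e) (body-cong f)
body-cong (≅-∀ e)       = e

∀'-injective : ∀ {A A'} → ∀' A ≅ ∀' A' → A ≅ A'
∀'-injective = body-cong

subst-cong : ∀ σ {A B} → A ≅ B → subst σ A ≅ subst σ B
subst-cong σ ≅-refl        = ≅-refl
subst-cong σ (≅-sym e)     = ≅-sym (subst-cong σ e)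
subst-cong σ (≅-trans e f) = ≅-trans (subst-cong σ e) (subst-cong σ f)
subst-cong σ ≅-comm        = ≅-comm
subst-cong σ ≅-assoc       = ≅-assoc
subst-cong σ ≅-distr       = ≅-distr
subst-cong σ (≅-⇒ e f)     = ≅-⇒ (subst-cong σ e) (subst-cong σ f)
subst-cong σ (≅-∧ e f)     = ≅-∧ (subst-cong σ e) (subst-cong σ f)
subst-cong σ (≅-∀ e)       = ≅-∀ (subst-cong (exts σ) e)

⦂-unique : ∀ {r A B} → r ⦂ A → r ⦂ B → A ≅ B
⦂-unique (conv d e) d'        = ≅-trans (≅-sym e) (⦂-unique d d')
⦂-unique d (conv d' e)        = ≅-trans (⦂-unique d d') e
⦂-unique ax ax                = ≅-refl
⦂-unique (⇒I d) (⇒I d')       = ≅-⇒ ≅-refl (⦂-unique d d')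
⦂-unique (⇒E d _) (⇒E d' _)   = ⇒-injectiveʳ (⦂-unique d d')
⦂-unique (∧I d s) (∧I d' s')  = ≅-∧ (⦂-unique d d') (⦂-unique s s')
⦂-unique (∧E _) (∧E _)        = ≅-refl
⦂-unique (∀I d _) (∀I d' _)   = ≅-∀ (⦂-unique d d')
⦂-unique (∀E {B = C} d) (∀E d') = subst-cong (single C) (∀'-injective (⦂-unique d d'))

lemma1 : ∀ (r : Term) (A B : Ty) → r ⦂ A → r ⦂ B → A ≅ B
lemma1 _ _ _ = ⦂-unique
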